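{- Let $(u,v)$ be an Anderson pair with $v$ in column $j\le0$ of the extended Fibonacci Zeckendorf array, and let $\delta(u,v)=-u+\phi^{ -1}v$. If $j$ is odd then $-\phi^{ -j}<\delta(u,v)<-\phi^{ -(j+2)}$; if $j$ is even then $\phi^{ -(j+2)}<\delta(u,v)<\phi^{ -j}$.
   Context: $F_0=0$, $F_1=1$, $F_i=F_{i-1}+F_{i-2}$; $\phi=(1+\sqrt5)/2$. For a bit string $\beta=\langle\beta_1\ldots\beta_\ell\rangle$, $\mathrm{FibSum}(\beta)=\sum_{i=1}^\ell\beta_iF_{i+1}$. The Zeckendorf representation of a positive integer $m$ is the unique bit string $\beta$ with $\mathrm{FibSum}(\beta)=m$, $\beta_\ell=1$, and no two consecutive 1s. Let $a_1<a_2<\cdots$ be the positive integers whose Zeckendorf representation has $\beta_1=1$. The extended Fibonacci Zeckendorf array has, for each $n\ge1$, a row $(x^{(n)}_i)_{i\in\mathbb Z}$ of integers determined by $x^{(n)}_1=a_n$, $x^{(n)}_2=\mathrm{FibSum}(\langle0\rangle\|\beta)$ where $\beta$ is the Zeckendorf representation of $a_n$ (i.e. $\langle0\,\beta_1\ldots\beta_\ell\rangle$), and $x^{(n)}_{i+1}=x^{(n)}_i+x^{(n)}_{i-1}$ for all $i\in\mathbb Z$; $i$ is the column index. An Anderson pair is a pair of integers $(u,v)$ occurring as adjacent entries $(x^{(n)}_{j-1},x^{(n)}_j)$ of some row; $v$ is then said to be in column $j$. -}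

module Defs where

open import Data.Nat as ℕ using (ℕ; zero; suc)
open import Data.Integer as ℤ using (ℤ; +_; -[1+_]; _+_; _-_; _*_; -_; _<_; _≤_)
open import Data.Bool using (Bool; true; false; if_then_else_)
open import Data.List using (List; []; _∷_)
open import Data.Product using (Σ; ∃; ∃-syntax; _×_; _,_)
open import Data.Sum using (_⊎_)
open import Data.Empty using (⊥)
open import Relation.Binary.PropositionalEquality using (_≡_)

fib : ℕ → ℕ
fib zero = zero
fib (suc zero) = suc zero
fib (suc (suc n)) = fib (suc n) ℕ.+ fib n

-- bit strings: β₁ is the head of the list
Bits : Set
Bits = List Bool

fibSumFrom : ℕ → Bits → ℕ
fibSumFrom k [] = zero
fibSumFrom k (b ∷ β) = (if b then fib k else zero) ℕ.+ fibSumFrom (suc k) β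

-- FibSum(β) = Σ_{i=1}^{ℓ} βᵢ F_{i+1}
FibSum : Bits → ℕ
FibSum = fibSumFrom 2

LastOne : Bits → Set
LastOne [] = ⊥
LastOne (true ∷ []) = Data.Unit.⊤ where import Data.Unit
LastOne (false ∷ []) = ⊥
LastOne (_ ∷ b ∷ β) = LastOne (b ∷ β)

NoConsecOnes : Bits → Set
NoConsecOnes [] = Data.Unit.⊤ where import Data.Unit
NoConsecOnes (_ ∷ []) = Data.Unit.⊤ where import Data.Unit
NoConsecOnes (true ∷ true ∷ β) = ⊥
NoConsecOnes (true ∷ false ∷ β) = NoConsecOnes (false ∷ β)
NoConsecOnes (false ∷ b ∷ β) = NoConsecOnes (b ∷ β)

IsZeckendorf : Bits → ℕ → Set
IsZeckendorf β m = (0 ℕ.< m) × (FibSum β ≡ m) × LastOne β × NoConsecOnes β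

FirstOne : Bits → Set
FirstOne [] = ⊥
FirstOne (b ∷ _) = b ≡ true

-- The row of the extended Fibonacci Zeckendorf array starting with m
-- (m ranges over the set {a₁ < a₂ < …}, i.e. positive integers whose
-- Zeckendorf representation β has β₁ = 1):
-- x is a row for m if x 1 = m, x 2 = FibSum(⟨0⟩ ∥ β), and the Fibonacci
-- recurrence holds at every integer index.
IsRow : (ℤ → ℤ) → Set
IsRow x = ∃[ m ] ∃[ β ]
  ( IsZeckendorf β m × FirstOne β
  × x (+ 1) ≡ + m
  × x (+ 2) ≡ + FibSum (false ∷ β)
  × (∀ (i : ℤ) → x (i + + 1) ≡ x i + x (i - + 1)) )

AndersonPairInColumn : ℤ → ℤ → ℤ → Set
AndersonPairInColumn u v j = ∃[ x ] (IsRow x × x (j - + 1) ≡ u × x j ≡ v)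

Odd Even : ℤ → Set
Odd j = ∃[ k ] j ≡ + 2 * k + + 1
Even j = ∃[ k ] j ≡ + 2 * k

-- The ring ℤ[φ] ⊆ ℝ, φ = (1+√5)/2, with its order inherited from ℝ.
-- ⟨ a , b ⟩ represents a + b φ.

record ℤφ : Set where
  constructor ⟨_,_⟩
  field
    re : ℤ
    ph : ℤ
open ℤφ public

fromℤ : ℤ → ℤφ
fromℤ a = ⟨ a , + 0 ⟩

infixl 6 _⊕_ _⊖_
infixl 7 _⊗_

_⊕_ : ℤφ → ℤφ → ℤφ
⟨ a , b ⟩ ⊕ ⟨ c , d ⟩ = ⟨ a + c , b + d ⟩

neg : ℤφ → ℤφ
neg ⟨ a , b ⟩ = ⟨ - a , - b ⟩

_⊖_ : ℤφ → ℤφ → ℤφ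
x ⊖ y = x ⊕ neg y

-- uses φ² = φ + 1
_⊗_ : ℤφ → ℤφ → ℤφ
⟨ a , b ⟩ ⊗ ⟨ c , d ⟩ = ⟨ a * c + b * d , a * d + b * c + b * d ⟩

φ : ℤφ
φ = ⟨ + 0 , + 1 ⟩

-- φ⁻¹ = φ - 1  (since φ (φ - 1) = φ² - φ = 1)
φ⁻¹ : ℤφ
φ⁻¹ = ⟨ -[1+ 0 ] , + 1 ⟩

powℕ : ℤφ → ℕ → ℤφ
powℕ x zero = ⟨ + 1 , + 0 ⟩
powℕ x (suc n) = x ⊗ powℕ x n

φ^ : ℤ → ℤφ
φ^ (+ n) = powℕ φ n
φ^ -[1+ n ] = powℕ φ⁻¹ (suc n)

-- c + d √5 > 0 (c, d integers): the order of ℝ restricted to ℤ[√5]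
Pos√5 : ℤ → ℤ → Set
Pos√5 c d =
    (+ 0 ≤ c × + 0 ≤ d × (+ 0 < c ⊎ + 0 < d))
  ⊎ (+ 0 < c × d < + 0 × + 5 * (d * d) < c * c)
  ⊎ (c < + 0 × + 0 < d × c * c < + 5 * (d * d))

-- a + b φ = ((2a + b) + b √5) / 2 > 0
Positive : ℤφ → Set
Positive ⟨ a , b ⟩ = Pos√5 (+ 2 * a + b) b

infix 4 _<φ_
_<φ_ : ℤφ → ℤφ → Set
x <φ y = Positive (y ⊖ x)

δ : ℤ → ℤ → ℤφ
δ u v = neg (fromℤ u) ⊕ φ⁻¹ ⊗ fromℤ v

{-# OPTIONS --safe #-}

-- Moving one column to the left multiplies δ by -φ: if r = q + p then
-- δ(p, q) = -φ δ(q, r).  Multiplication by -φ reverses the order of ℝ and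
-- sends ±φ^i to ∓φ^(i+1), so it suffices to show φ^-2 < δ < 1 in column 0.
-- There the row entries are Σ βᵢ F_{i-1} and Σ βᵢ F_i, so δ = -Σ βᵢ ψ^i with
-- ψ = 1 - φ = -φ⁻¹.  For a string without two consecutive 1s this value
-- lies in (-φ⁻¹, 1), and in (φ^-2, 1) when β₁ = 1, by induction on β.
--
-- Inequalities in ℤ[φ] are proved through positivity certificates: x > 0 as
-- soon as some φ^k x has nonnegative coordinates (not both 0).  Unlike the
-- definition of Positive, certificates are visibly closed under addition and
-- multiplication by φ^±1.

module Submission where

open import Defs
open import Data.Bool using (true; false)
open import Data.Empty using (⊥; ⊥-elim)
open import Data.Integer
  using (ℤ; +_; -[1+_]; +[1+_]; 0ℤ; _+_; _-_; -_; _*_; _<_; _≤_; +<+; +≤+)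
import Data.Integer.Properties
open Data.Integer.Properties
  using (<-cmp; _≤?_; _<?_; ≰⇒>; <⇒≤; ≤-refl; <-≤-trans; ≤-<-trans; ≤-trans; +-mono-<; +-mono-≤
        ; +-mono-<-≤; +-monoʳ-<; +-monoʳ-≤; +-monoˡ-<; +-identityʳ; +-inverseʳ; *-identityˡ
        ; neg-mono-<; neg-mono-≤; neg-involutive; neg-distrib-+; pos-+
        ; *-monoˡ-≤-nonNeg; *-monoʳ-≤-nonNeg; *-monoˡ-<-pos; *-monoʳ-<-pos)
open import Data.Integer.Tactic.RingSolver using (solve-∀)
import Algebra.Properties.CommutativeSemigroup as CommSemigroupProperties
open import Data.Integer.Base using (nonNegative; positive)
open import Data.List using ([]; _∷_)
open import Data.Nat using (ℕ; zero; suc)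
import Data.Nat as ℕ
import Data.Nat.Properties as ℕ
open import Data.Product using (∃-syntax; _×_; _,_)
import Data.Product
open import Data.Sum using (_⊎_; inj₁; inj₂; [_,_])
import Data.Sum
open import Data.Unit using (tt)
open import Function using (_$_)
open import Relation.Binary.Definitions using (tri<; tri≈; tri>)
open import Relation.Binary.PropositionalEquality
  using (_≡_; refl; sym; trans; cong; cong₂; subst; module ≡-Reasoning)
open import Relation.Nullary using (Dec; yes; no)
open import Relation.Nullary.Decidable using (True; toWitness; from-yes; _×-dec_; _⊎-dec_)

private
  module ℤ+ = CommSemigroupProperties Data.Integer.Properties.+-commutativeSemigroup
  module ℕ+ = CommSemigroupProperties ℕ.+-commutativeSemigroup

<-from-gap : ∀ {x y} d → y ≡ x + d → 0ℤ < d → x < y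
<-from-gap {x} d refl 0<d = subst (_< x + d) (+-identityʳ x) (+-monoʳ-< x 0<d)

≤-from-gap : ∀ {x y} d → y ≡ x + d → 0ℤ ≤ d → x ≤ y
≤-from-gap {x} d refl 0≤d = subst (_≤ x + d) (+-identityʳ x) (+-monoʳ-≤ x 0≤d)

0<i+i⇒0<i : ∀ {i} → 0ℤ < i + i → 0ℤ < i
0<i+i⇒0<i {+[1+ n ]} _ = +<+ (ℕ.s≤s ℕ.z≤n)
0<i+i⇒0<i {+ zero} (+<+ ())
0<i+i⇒0<i { -[1+ n ]} ()

0<i*i : ∀ {i} → 0ℤ < i ⊎ i < 0ℤ → 0ℤ < i * i
0<i*i {+[1+ n ]} _ = +<+ (ℕ.s≤s ℕ.z≤n)
0<i*i { -[1+ n ]} _ = +<+ (ℕ.s≤s ℕ.z≤n)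
0<i*i {+ zero} (inj₁ (+<+ ()))
0<i*i {+ zero} (inj₂ (+<+ ()))

*-self-mono-≤ : ∀ {i j} → 0ℤ ≤ i → i ≤ j → i * i ≤ j * j
*-self-mono-≤ {i} {j} 0≤i i≤j =
  ≤-trans (*-monoˡ-≤-nonNeg i {{nonNegative 0≤i}} i≤j)
          (*-monoʳ-≤-nonNeg j {{nonNegative (≤-trans 0≤i i≤j)}} i≤j)

<⇒0<-diff : ∀ {i j} → i < j → 0ℤ < j - i
<⇒0<-diff {i} {j} i<j = subst (_< j - i) (+-inverseʳ i) (+-monoˡ-< (- i) i<j)

0<-i⇒i<0 : ∀ {i} → 0ℤ < - i → i < 0ℤ
0<-i⇒i<0 {i} 0<-i = subst (_< 0ℤ) (neg-involutive i) (neg-mono-< 0<-i)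

-- Positivity in ℤ[φ]

φ* : ℤφ → ℤφ
φ* ⟨ a , b ⟩ = ⟨ b , a + b ⟩

-- Positive (φ* ⟨ a , b ⟩) is Pos√5 P Q with P = + 2 * b + (a + b) and
-- Q = a + b; each lemma below handles one disjunct of Pos√5 P Q.
private
  cancel-φ*-nonneg : ∀ a b → 0ℤ ≤ + 2 * b + (a + b) → 0ℤ ≤ a + b →
                     0ℤ < + 2 * b + (a + b) ⊎ 0ℤ < a + b → Positive ⟨ a , b ⟩
  cancel-φ*-nonneg a b 0≤P 0≤Q 0<P⊎Q with <-cmp b 0ℤ
  ... | tri≈ _ refl _ = inj₁ (<⇒≤ 0<c , ≤-refl , inj₁ 0<c)
    where
    P≡a : ∀ a → + 2 * + 0 + (a + + 0) ≡ a
    P≡a = solve-∀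
    a+a≡c : ∀ a → a + a ≡ + 2 * a + + 0
    a+a≡c = solve-∀
    0<a : 0ℤ < a
    0<a = [ subst (0ℤ <_) (P≡a a) , subst (0ℤ <_) (+-identityʳ a) ] 0<P⊎Q
    0<c : 0ℤ < + 2 * a + + 0
    0<c = subst (0ℤ <_) (a+a≡c a) (+-mono-< 0<a 0<a)
  ... | tri> _ _ 0<b with 0ℤ ≤? + 2 * a + b
  ...   | yes 0≤c = inj₁ (0≤c , <⇒≤ 0<b , inj₂ 0<b)
  ...   | no c≱0 = inj₂ (inj₂ (c<0 , 0<b , ≤-<-trans c²≤b² b²<5b²))
    where
    c = + 2 * a + b
    c<0 = ≰⇒> c≱0
    b≡-c+2Q : ∀ a b → b ≡ - (+ 2 * a + b) + ((a + b) + (a + b))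
    b≡-c+2Q = solve-∀
    -c≤b : - c ≤ b
    -c≤b = ≤-from-gap ((a + b) + (a + b)) (b≡-c+2Q a b) (+-mono-≤ 0≤Q 0≤Q)
    c²≡[-c]² : ∀ c → - c * - c ≡ c * c
    c²≡[-c]² = solve-∀
    c²≤b² : c * c ≤ b * b
    c²≤b² = subst (_≤ b * b) (c²≡[-c]² c) (*-self-mono-≤ (neg-mono-≤ (<⇒≤ c<0)) -c≤b)
    b²<5b² : b * b < + 5 * (b * b)
    b²<5b² = subst (_< + 5 * (b * b)) (*-identityˡ (b * b))
               (*-monoʳ-<-pos (b * b) {{positive (0<i*i (inj₁ 0<b))}} (from-yes (+ 1 <? + 5)))
  cancel-φ*-nonneg a b 0≤P 0≤Q 0<P⊎Q | tri< b<0 _ _ =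
    inj₂ (inj₁ (0<c , b<0 , <-≤-trans 5b²<25b² 25b²≤c²))
    where
    c = + 2 * a + b
    c≡5[-b]+2P : ∀ a b → + 2 * a + b ≡ + 5 * - b + ((+ 2 * b + (a + b)) + (+ 2 * b + (a + b)))
    c≡5[-b]+2P = solve-∀
    5[-b]≤c : + 5 * - b ≤ c
    5[-b]≤c = ≤-from-gap _ (c≡5[-b]+2P a b) (+-mono-≤ 0≤P 0≤P)
    0<5[-b] : 0ℤ < + 5 * - b
    0<5[-b] = *-monoˡ-<-pos (+ 5) (neg-mono-< b<0)
    0<c : 0ℤ < c
    0<c = <-≤-trans 0<5[-b] 5[-b]≤c
    5b²<25b² : + 5 * (b * b) < + 25 * (b * b)
    5b²<25b² = *-monoʳ-<-pos (b * b) {{positive (0<i*i (inj₂ b<0))}} (from-yes (+ 5 <? + 25))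
    25b²≡[5[-b]]² : ∀ b → + 25 * (b * b) ≡ + 5 * - b * (+ 5 * - b)
    25b²≡[5[-b]]² = solve-∀
    25b²≤c² : + 25 * (b * b) ≤ c * c
    25b²≤c² = subst (_≤ c * c) (sym (25b²≡[5[-b]]² b)) (*-self-mono-≤ (<⇒≤ 0<5[-b]) 5[-b]≤c)

  cancel-φ*-pos-neg : ∀ a b → 0ℤ < + 2 * b + (a + b) → a + b < 0ℤ →
                      + 5 * ((a + b) * (a + b)) < (+ 2 * b + (a + b)) * (+ 2 * b + (a + b)) →
                      Positive ⟨ a , b ⟩
  cancel-φ*-pos-neg a b 0<P Q<0 5Q²<P² =
    inj₂ (inj₂ (c<0 , 0<b , <-from-gap _ (5b²≡c²+[P²-5Q²] a b) (<⇒0<-diff 5Q²<P²)))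
    where
    P-Q≡2b : ∀ a b → + 2 * b + (a + b) + - (a + b) ≡ b + b
    P-Q≡2b = solve-∀
    0<b : 0ℤ < b
    0<b = 0<i+i⇒0<i (subst (0ℤ <_) (P-Q≡2b a b) (+-mono-< 0<P (neg-mono-< Q<0)))
    -c≡-2Q+b : ∀ a b → - (a + b) + - (a + b) + b ≡ - (+ 2 * a + b)
    -c≡-2Q+b = solve-∀
    c<0 : + 2 * a + b < 0ℤ
    c<0 = 0<-i⇒i<0 (subst (0ℤ <_) (-c≡-2Q+b a b) (+-mono-< (+-mono-< (neg-mono-< Q<0) (neg-mono-< Q<0)) 0<b))
    5b²≡c²+[P²-5Q²] : ∀ a b → + 5 * (b * b) ≡ (+ 2 * a + b) * (+ 2 * a + b) +
      ((+ 2 * b + (a + b)) * (+ 2 * b + (a + b)) - + 5 * ((a + b) * (a + b)))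
    5b²≡c²+[P²-5Q²] = solve-∀

  cancel-φ*-neg-pos : ∀ a b → + 2 * b + (a + b) < 0ℤ → 0ℤ < a + b →
                      (+ 2 * b + (a + b)) * (+ 2 * b + (a + b)) < + 5 * ((a + b) * (a + b)) →
                      Positive ⟨ a , b ⟩
  cancel-φ*-neg-pos a b P<0 0<Q P²<5Q² =
    inj₂ (inj₁ (0<c , b<0 , <-from-gap _ (c²≡5b²+[5Q²-P²] a b) (<⇒0<-diff P²<5Q²)))
    where
    Q-P≡-2b : ∀ a b → - (+ 2 * b + (a + b)) + (a + b) ≡ - b + - b
    Q-P≡-2b = solve-∀
    b<0 : b < 0ℤ
    b<0 = 0<-i⇒i<0 (0<i+i⇒0<i (subst (0ℤ <_) (Q-P≡-2b a b) (+-mono-< (neg-mono-< P<0) 0<Q)))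
    c≡2Q-b : ∀ a b → (a + b) + (a + b) + - b ≡ + 2 * a + b
    c≡2Q-b = solve-∀
    0<c : 0ℤ < + 2 * a + b
    0<c = subst (0ℤ <_) (c≡2Q-b a b) (+-mono-< (+-mono-< 0<Q 0<Q) (neg-mono-< b<0))
    c²≡5b²+[5Q²-P²] : ∀ a b → (+ 2 * a + b) * (+ 2 * a + b) ≡ + 5 * (b * b) +
      (+ 5 * ((a + b) * (a + b)) - (+ 2 * b + (a + b)) * (+ 2 * b + (a + b)))
    c²≡5b²+[5Q²-P²] = solve-∀

Positive-cancel-φ* : ∀ x → Positive (φ* x) → Positive x
Positive-cancel-φ* ⟨ a , b ⟩ (inj₁ (0≤P , 0≤Q , 0<P⊎Q)) = cancel-φ*-nonneg a b 0≤P 0≤Q 0<P⊎Q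
Positive-cancel-φ* ⟨ a , b ⟩ (inj₂ (inj₁ (0<P , Q<0 , 5Q²<P²))) = cancel-φ*-pos-neg a b 0<P Q<0 5Q²<P²
Positive-cancel-φ* ⟨ a , b ⟩ (inj₂ (inj₂ (P<0 , 0<Q , P²<5Q²))) = cancel-φ*-neg-pos a b P<0 0<Q P²<5Q²

CoordPos : ℤφ → Set
CoordPos ⟨ a , b ⟩ = 0ℤ ≤ a × 0ℤ ≤ b × (0ℤ < a ⊎ 0ℤ < b)

coordPos? : ∀ x → Dec (CoordPos x)
coordPos? ⟨ a , b ⟩ = (0ℤ ≤? a) ×-dec (0ℤ ≤? b) ×-dec ((0ℤ <? a) ⊎-dec (0ℤ <? b))

CoordPos⇒Positive : ∀ x → CoordPos x → Positive x
CoordPos⇒Positive ⟨ a , b ⟩ (0≤a , 0≤b , 0<a⊎b) = inj₁ (0≤c , 0≤b , Data.Sum.map₁ 0<c 0<a⊎b)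
  where
  a+a+b≡c : ∀ a b → a + a + b ≡ + 2 * a + b
  a+a+b≡c = solve-∀
  0≤c : 0ℤ ≤ + 2 * a + b
  0≤c = subst (0ℤ ≤_) (a+a+b≡c a b) (+-mono-≤ (+-mono-≤ 0≤a 0≤a) 0≤b)
  0<c : 0ℤ < a → 0ℤ < + 2 * a + b
  0<c 0<a = subst (0ℤ <_) (a+a+b≡c a b) (+-mono-<-≤ (+-mono-< 0<a 0<a) 0≤b)

CoordPos-φ* : ∀ {x} → CoordPos x → CoordPos (φ* x)
CoordPos-φ* (0≤a , 0≤b , inj₁ 0<a) = 0≤b , +-mono-≤ 0≤a 0≤b , inj₂ (+-mono-<-≤ 0<a 0≤b)
CoordPos-φ* (0≤a , 0≤b , inj₂ 0<b) = 0≤b , +-mono-≤ 0≤a 0≤b , inj₁ 0<b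

CoordPos-⊕ : ∀ {x y} → CoordPos x → CoordPos y → CoordPos (x ⊕ y)
CoordPos-⊕ (0≤a , 0≤b , 0<a⊎b) (0≤c , 0≤d , 0<c⊎d) =
    +-mono-≤ 0≤a 0≤c , +-mono-≤ 0≤b 0≤d
  , Data.Sum.map (λ 0<a → +-mono-<-≤ 0<a 0≤c) (λ 0<b → +-mono-<-≤ 0<b 0≤d) 0<a⊎b

φ*^ : ℕ → ℤφ → ℤφ
φ*^ zero x = x
φ*^ (suc k) x = φ*^ k (φ* x)

φ*^-φ* : ∀ k x → φ*^ k (φ* x) ≡ φ* (φ*^ k x)
φ*^-φ* zero x = refl
φ*^-φ* (suc k) x = φ*^-φ* k (φ* x)

φ*^-+ : ∀ k l x → φ*^ (k ℕ.+ l) x ≡ φ*^ l (φ*^ k x)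
φ*^-+ zero l x = refl
φ*^-+ (suc k) l x = φ*^-+ k l (φ* x)

φ*-⊕ : ∀ x y → φ* (x ⊕ y) ≡ φ* x ⊕ φ* y
φ*-⊕ ⟨ a , b ⟩ ⟨ c , d ⟩ = cong ⟨ b + d ,_⟩ (ℤ+.interchange a c b d)

φ*^-⊕ : ∀ k x y → φ*^ k (x ⊕ y) ≡ φ*^ k x ⊕ φ*^ k y
φ*^-⊕ zero x y = refl
φ*^-⊕ (suc k) x y = trans (cong (φ*^ k) (φ*-⊕ x y)) (φ*^-⊕ k (φ* x) (φ* y))

CoordPos-φ*^ : ∀ k {x} → CoordPos x → CoordPos (φ*^ k x)
CoordPos-φ*^ zero p = p
CoordPos-φ*^ (suc k) p = CoordPos-φ*^ k (CoordPos-φ* p)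

Positiveᶜ : ℤφ → Set
Positiveᶜ x = ∃[ k ] CoordPos (φ*^ k x)

Positiveᶜ⇒Positive : ∀ {x} → Positiveᶜ x → Positive x
Positiveᶜ⇒Positive (k , p) = sound k _ p
  where
  sound : ∀ k x → CoordPos (φ*^ k x) → Positive x
  sound zero x p = CoordPos⇒Positive x p
  sound (suc k) x p = Positive-cancel-φ* x (sound k (φ* x) p)

Positiveᶜ-⊕ : ∀ {x y} → Positiveᶜ x → Positiveᶜ y → Positiveᶜ (x ⊕ y)
Positiveᶜ-⊕ {x} {y} (k , p) (l , q) =
  k ℕ.+ l , subst CoordPos (sym (φ*^-⊕ (k ℕ.+ l) x y)) (CoordPos-⊕ p′ q′)
  where
  p′ : CoordPos (φ*^ (k ℕ.+ l) x)
  p′ = subst CoordPos (sym (φ*^-+ k l x)) (CoordPos-φ*^ l p)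
  q′ : CoordPos (φ*^ (k ℕ.+ l) y)
  q′ = subst CoordPos (trans (sym (φ*^-+ l k y)) (cong (λ n → φ*^ n y) (ℕ.+-comm l k))) (CoordPos-φ*^ k q)

Positiveᶜ-φ* : ∀ {x} → Positiveᶜ x → Positiveᶜ (φ* x)
Positiveᶜ-φ* {x} (k , p) = k , subst CoordPos (sym (φ*^-φ* k x)) (CoordPos-φ* p)

Positiveᶜ-cancel-φ* : ∀ {x} → Positiveᶜ (φ* x) → Positiveᶜ x
Positiveᶜ-cancel-φ* (k , p) = suc k , p

infix 4 _<ᶜ_ _<ᶜ_<ᶜ_

record _<ᶜ_ (x y : ℤφ) : Set where
  constructor positive-gap
  field gap : Positiveᶜ (y ⊖ x)

_<ᶜ_<ᶜ_ : ℤφ → ℤφ → ℤφ → Set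
a <ᶜ x <ᶜ b = (a <ᶜ x) × (x <ᶜ b)

<ᶜ⇒<φ : ∀ {x y} → x <ᶜ y → x <φ y
<ᶜ⇒<φ (positive-gap p) = Positiveᶜ⇒Positive p

decide-<ᶜ : ∀ k {x y} → {True (coordPos? (φ*^ k (y ⊖ x)))} → x <ᶜ y
decide-<ᶜ k {x} {y} {p} = positive-gap (k , toWitness p)

<ᶜ-trans : ∀ {x y z} → x <ᶜ y → y <ᶜ z → x <ᶜ z
<ᶜ-trans {⟨ x₁ , x₂ ⟩} {⟨ y₁ , y₂ ⟩} {⟨ z₁ , z₂ ⟩} (positive-gap x<y) (positive-gap y<z) =
  positive-gap $
    subst Positiveᶜ (cong₂ ⟨_,_⟩ (telescope x₁ y₁ z₁) (telescope x₂ y₂ z₂)) (Positiveᶜ-⊕ x<y y<z)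
  where
  telescope : ∀ x y z → y + - x + (z + - y) ≡ z + - x
  telescope = solve-∀

⊕-monoʳ-<ᶜ : ∀ c {x y} → x <ᶜ y → c ⊕ x <ᶜ c ⊕ y
⊕-monoʳ-<ᶜ ⟨ c₁ , c₂ ⟩ {⟨ x₁ , x₂ ⟩} {⟨ y₁ , y₂ ⟩} (positive-gap x<y) =
  positive-gap $ subst Positiveᶜ (cong₂ ⟨_,_⟩ (cancel c₁ x₁ y₁) (cancel c₂ x₂ y₂)) x<y
  where
  cancel : ∀ c x y → y + - x ≡ c + y + - (c + x)
  cancel = solve-∀

−φ* : ℤφ → ℤφ
−φ* x = neg (φ* x)

-- multiplication by ψ = 1 - φ = - φ⁻¹
ψ* : ℤφ → ℤφ
ψ* ⟨ a , b ⟩ = ⟨ a - b , - a ⟩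

−φ*-antitone : ∀ {x y} → x <ᶜ y → −φ* y <ᶜ −φ* x
−φ*-antitone {⟨ x₁ , x₂ ⟩} {⟨ y₁ , y₂ ⟩} (positive-gap x<y) =
  positive-gap $
    subst Positiveᶜ (cong₂ ⟨_,_⟩ (re-eq x₂ y₂) (ph-eq x₁ x₂ y₁ y₂)) (Positiveᶜ-φ* x<y)
  where
  re-eq : ∀ x₂ y₂ → y₂ + - x₂ ≡ - x₂ + - - y₂
  re-eq = solve-∀
  ph-eq : ∀ x₁ x₂ y₁ y₂ → y₁ + - x₁ + (y₂ + - x₂) ≡ - (x₁ + x₂) + - - (y₁ + y₂)
  ph-eq = solve-∀

ψ*-antitone : ∀ {x y} → x <ᶜ y → ψ* y <ᶜ ψ* x
ψ*-antitone {⟨ x₁ , x₂ ⟩} {⟨ y₁ , y₂ ⟩} (positive-gap x<y) =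
  positive-gap $ Positiveᶜ-cancel-φ* $
    subst Positiveᶜ (cong₂ ⟨_,_⟩ (re-eq x₁ y₁) (ph-eq x₁ x₂ y₁ y₂)) x<y
  where
  re-eq : ∀ x₁ y₁ → y₁ + - x₁ ≡ - x₁ + - - y₁
  re-eq = solve-∀
  ph-eq : ∀ x₁ x₂ y₁ y₂ → y₂ + - x₂ ≡ x₁ - x₂ + - (y₁ - y₂) + (- x₁ + - - y₁)
  ph-eq = solve-∀

φ⊗≡φ* : ∀ x → φ ⊗ x ≡ φ* x
φ⊗≡φ* ⟨ a , b ⟩ = cong₂ ⟨_,_⟩ (re-eq a b) (ph-eq a b)
  where
  re-eq : ∀ a b → + 0 * a + + 1 * b ≡ b
  re-eq = solve-∀
  ph-eq : ∀ a b → + 0 * b + + 1 * a + + 1 * b ≡ a + b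
  ph-eq = solve-∀

φ*-φ⁻¹⊗ : ∀ x → φ* (φ⁻¹ ⊗ x) ≡ x
φ*-φ⁻¹⊗ ⟨ a , b ⟩ = cong₂ ⟨_,_⟩ (re-eq a b) (ph-eq a b)
  where
  re-eq : ∀ a b → -[1+ 0 ] * b + + 1 * a + + 1 * b ≡ a
  re-eq = solve-∀
  ph-eq : ∀ a b → -[1+ 0 ] * a + + 1 * b + (-[1+ 0 ] * b + + 1 * a + + 1 * b) ≡ b
  ph-eq = solve-∀

φ^-suc : ∀ i → φ^ (i + + 1) ≡ φ* (φ^ i)
φ^-suc (+ n) = trans (cong (powℕ φ) (ℕ.+-comm n 1)) (φ⊗≡φ* (powℕ φ n))
φ^-suc -[1+ zero ] = refl
φ^-suc -[1+ suc n ] = sym (φ*-φ⁻¹⊗ (powℕ φ⁻¹ (suc n)))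

−φ*-φ^ : ∀ i → −φ* (φ^ i) ≡ neg (φ^ (i + + 1))
−φ*-φ^ i = cong neg (sym (φ^-suc i))

−φ*-neg-φ^ : ∀ i → −φ* (neg (φ^ i)) ≡ φ^ (i + + 1)
−φ*-neg-φ^ i = trans (−φ*-neg (φ^ i)) (sym (φ^-suc i))
  where
  −φ*-neg : ∀ x → −φ* (neg x) ≡ φ* x
  −φ*-neg ⟨ a , b ⟩ =
    cong₂ ⟨_,_⟩ (neg-involutive b) (trans (cong -_ (sym (neg-distrib-+ a b))) (neg-involutive (a + b)))

-- Fibonacci recurrences

δ≡ : ∀ u v → δ u v ≡ ⟨ - u - v , v ⟩
δ≡ u v = cong₂ ⟨_,_⟩ (re-eq u v) (ph-eq v)
  where
  re-eq : ∀ u v → - u + (-[1+ 0 ] * v + + 1 * + 0) ≡ - u - v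
  re-eq = solve-∀
  ph-eq : ∀ v → + 0 + (-[1+ 0 ] * + 0 + + 1 * v + + 1 * + 0) ≡ v
  ph-eq = solve-∀

δ-step : ∀ p q r → r ≡ q + p → δ p q ≡ −φ* (δ q r)
δ-step p q _ refl = begin
  δ p q                                              ≡⟨ δ≡ p q ⟩
  ⟨ - p - q , q ⟩                                    ≡⟨ cong₂ ⟨_,_⟩ (re-eq p q) (ph-eq p q) ⟩
  −φ* ⟨ - q - (q + p) , q + p ⟩                      ≡⟨ cong −φ* (sym (δ≡ q (q + p))) ⟩
  −φ* (δ q (q + p))                                  ∎
  where
  open ≡-Reasoning
  re-eq : ∀ p q → - p - q ≡ - (q + p)
  re-eq = solve-∀
  ph-eq : ∀ p q → q ≡ - (- q - (q + p) + (q + p))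
  ph-eq = solve-∀

δ-ψ* : ∀ a b → δ a (a + b) ≡ ψ* (δ b a)
δ-ψ* a b = trans (δ≡ a (a + b)) (trans (cong₂ ⟨_,_⟩ (re-eq a b) (ph-eq a b)) (cong ψ* (sym (δ≡ b a))))
  where
  re-eq : ∀ a b → - a - (a + b) ≡ - b - a - a
  re-eq = solve-∀
  ph-eq : ∀ a b → a + b ≡ - (- b - a)
  ph-eq = solve-∀

δ-φ⁻¹ψ* : ∀ a b → δ a (+ 1 + (a + b)) ≡ φ⁻¹ ⊕ ψ* (δ b a)
δ-φ⁻¹ψ* a b = trans (δ≡ a (+ 1 + (a + b)))
  (trans (cong₂ ⟨_,_⟩ (re-eq a b) (ph-eq a b)) (cong (λ d → φ⁻¹ ⊕ ψ* d) (sym (δ≡ b a))))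
  where
  re-eq : ∀ a b → - a - (+ 1 + (a + b)) ≡ -[1+ 0 ] + (- b - a - a)
  re-eq = solve-∀
  ph-eq : ∀ a b → + 1 + (a + b) ≡ + 1 + - (- b - a)
  ph-eq = solve-∀

fibSumFrom-rec : ∀ k β → fibSumFrom (suc (suc k)) β ≡ fibSumFrom (suc k) β ℕ.+ fibSumFrom k β
fibSumFrom-rec k [] = refl
fibSumFrom-rec k (false ∷ β) = fibSumFrom-rec (suc k) β
fibSumFrom-rec k (true ∷ β) =
  trans (cong (fib (suc (suc k)) ℕ.+_) (fibSumFrom-rec (suc k) β))
        (ℕ+.interchange (fib (suc k)) (fib k) (fibSumFrom (suc (suc k)) β) (fibSumFrom (suc k) β))

+fibSumFrom-rec : ∀ k β → + fibSumFrom (suc (suc k)) β ≡ + fibSumFrom (suc k) β + + fibSumFrom k β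
+fibSumFrom-rec k β = trans (cong +_ (fibSumFrom-rec k β)) (pos-+ (fibSumFrom (suc k) β) (fibSumFrom k β))

fibδ : Bits → ℤφ
fibδ β = δ (+ fibSumFrom 0 β) (+ fibSumFrom 1 β)

fibδ-false : ∀ β → fibδ (false ∷ β) ≡ ψ* (fibδ β)
fibδ-false β = trans (cong (δ (+ fibSumFrom 1 β)) (+fibSumFrom-rec 0 β))
                    (δ-ψ* (+ fibSumFrom 1 β) (+ fibSumFrom 0 β))

fibδ-true : ∀ β → fibδ (true ∷ β) ≡ φ⁻¹ ⊕ ψ* (fibδ β)
fibδ-true β = trans (cong (λ s → δ (+ fibSumFrom 1 β) (+ 1 + s)) (+fibSumFrom-rec 0 β))
                   (δ-φ⁻¹ψ* (+ fibSumFrom 1 β) (+ fibSumFrom 0 β))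

noConsecOnes-tail : ∀ b γ → NoConsecOnes (b ∷ γ) → NoConsecOnes γ
noConsecOnes-tail b [] _ = tt
noConsecOnes-tail true (true ∷ γ) ()
noConsecOnes-tail true (false ∷ γ) nc = nc
noConsecOnes-tail false (c ∷ γ) nc = nc

ψ*-between : ∀ {a x b} → a <ᶜ x <ᶜ b → ψ* b <ᶜ ψ* x <ᶜ ψ* a
ψ*-between (a<x , x<b) = ψ*-antitone x<b , ψ*-antitone a<x

⊕-between : ∀ c {a x b} → a <ᶜ x <ᶜ b → c ⊕ a <ᶜ c ⊕ x <ᶜ c ⊕ b
⊕-between c (a<x , x<b) = ⊕-monoʳ-<ᶜ c a<x , ⊕-monoʳ-<ᶜ c x<b

1φ : ℤφ
1φ = ⟨ + 1 , + 0 ⟩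

φ⁻² : ℤφ
φ⁻² = φ⁻¹ ⊗ φ⁻¹

-- The endpoints match up definitionally: ψ* 1φ = neg φ⁻¹, ψ* (neg φ⁻¹) = φ⁻²,
-- φ⁻¹ ⊕ ψ* φ⁻² = φ⁻² and φ⁻¹ ⊕ ψ* (neg φ⁻¹) = 1φ.
mutual
  fibδ-bound : ∀ γ → NoConsecOnes γ → neg φ⁻¹ <ᶜ fibδ γ <ᶜ 1φ
  fibδ-bound [] _ = decide-<ᶜ 1 , decide-<ᶜ 0
  fibδ-bound (false ∷ γ) nc with fibδ-bound-false γ (noConsecOnes-tail false γ nc)
  ... | l , u = l , <ᶜ-trans u (decide-<ᶜ 1)
  fibδ-bound (true ∷ γ) nc with fibδ-bound-true γ nc
  ... | l , u = <ᶜ-trans (decide-<ᶜ 0) l , u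

  fibδ-bound-false : ∀ γ → NoConsecOnes γ → neg φ⁻¹ <ᶜ fibδ (false ∷ γ) <ᶜ φ⁻²
  fibδ-bound-false γ nc =
    subst (λ z → neg φ⁻¹ <ᶜ z <ᶜ φ⁻²) (sym (fibδ-false γ)) (ψ*-between (fibδ-bound γ nc))

  fibδ-bound-true : ∀ γ → NoConsecOnes (true ∷ γ) → φ⁻² <ᶜ fibδ (true ∷ γ) <ᶜ 1φ
  fibδ-bound-true [] _ = decide-<ᶜ 3 , decide-<ᶜ 2
  fibδ-bound-true (false ∷ γ) nc =
    subst (λ z → φ⁻² <ᶜ z <ᶜ 1φ) (sym (fibδ-true (false ∷ γ)))
          (⊕-between φ⁻¹ (ψ*-between (fibδ-bound-false γ (noConsecOnes-tail false γ nc))))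

-- Columns of a row

colδ : (ℤ → ℤ) → ℤ → ℤφ
colδ x j = δ (x (j - + 1)) (x j)

FibonacciRecurrence : (ℤ → ℤ) → Set
FibonacciRecurrence x = ∀ i → x (i + + 1) ≡ x i + x (i - + 1)

j-1+1≡j : ∀ j → j - + 1 + + 1 ≡ j
j-1+1≡j = solve-∀

colδ-pred : ∀ x → FibonacciRecurrence x → ∀ j → colδ x (j - + 1) ≡ −φ* (colδ x j)
colδ-pred x rec j =
  δ-step (x (j - + 1 - + 1)) (x (j - + 1)) (x j) (trans (cong x (sym (j-1+1≡j j))) (rec (j - + 1)))

fibδ-column : ∀ β → fibδ β ≡ −φ* (−φ* (δ (+ fibSumFrom 2 β) (+ fibSumFrom 3 β)))
fibδ-column β =
  trans (δ-step (+ fibSumFrom 0 β) (+ fibSumFrom 1 β) (+ fibSumFrom 2 β) (+fibSumFrom-rec 0 β))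
        (cong −φ* (δ-step (+ fibSumFrom 1 β) (+ fibSumFrom 2 β) (+ fibSumFrom 3 β) (+fibSumFrom-rec 1 β)))

row-recurrence : ∀ x → IsRow x → FibonacciRecurrence x
row-recurrence _ (_ , _ , _ , _ , _ , _ , rec) = rec

colδ-zero-bound : ∀ x → IsRow x → φ⁻² <ᶜ colδ x (+ 0) <ᶜ 1φ
colδ-zero-bound _ (_ , [] , _ , () , _)
colδ-zero-bound x (_ , b ∷ γ , (_ , FibSum≡m , _ , nc) , refl , x₁≡m , x₂≡FibSum , rec) =
  subst (λ z → φ⁻² <ᶜ z <ᶜ 1φ) (sym colδ-zero) (fibδ-bound-true γ nc)
  where
  open ≡-Reasoning
  β = true ∷ γ
  column-two : δ (x (+ 1)) (x (+ 2)) ≡ δ (+ fibSumFrom 2 β) (+ fibSumFrom 3 β)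
  column-two = cong₂ δ (trans x₁≡m (cong +_ (sym FibSum≡m))) x₂≡FibSum
  colδ-zero : colδ x (+ 0) ≡ fibδ β
  colδ-zero = begin
    colδ x (+ 0)                                         ≡⟨ colδ-pred x rec (+ 1) ⟩
    −φ* (colδ x (+ 1))                                   ≡⟨ cong −φ* (colδ-pred x rec (+ 2)) ⟩
    −φ* (−φ* (δ (x (+ 1)) (x (+ 2))))                    ≡⟨ cong (λ d → −φ* (−φ* d)) column-two ⟩
    −φ* (−φ* (δ (+ fibSumFrom 2 β) (+ fibSumFrom 3 β)))  ≡⟨ sym (fibδ-column β) ⟩
    fibδ β                                               ∎

odd-pred⇒even : ∀ {j} → Odd (j - + 1) → Even j
odd-pred⇒even {j} (k , j-1≡2k+1) = k + + 1 , (begin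
  j                    ≡⟨ sym (j-1+1≡j j) ⟩
  j - + 1 + + 1        ≡⟨ cong (_+ + 1) j-1≡2k+1 ⟩
  + 2 * k + + 1 + + 1  ≡⟨ twice-suc k ⟩
  + 2 * (k + + 1)      ∎)
  where
  open ≡-Reasoning
  twice-suc : ∀ k → + 2 * k + + 1 + + 1 ≡ + 2 * (k + + 1)
  twice-suc = solve-∀

even-pred⇒odd : ∀ {j} → Even (j - + 1) → Odd j
even-pred⇒odd {j} (k , j-1≡2k) = k , trans (sym (j-1+1≡j j)) (cong (_+ + 1) j-1≡2k)

¬odd-0 : Odd (+ 0) → ⊥
¬odd-0 (+ zero , ())
¬odd-0 (+[1+ n ] , ())
¬odd-0 (-[1+ zero ] , ())
¬odd-0 (-[1+ suc n ] , ())

ColumnBounds : (ℤφ → ℤφ → Set) → ℤ → ℤφ → Set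
ColumnBounds _≺_ j d =
    (Odd j → (neg (φ^ (- j)) ≺ d) × (d ≺ neg (φ^ (- (j + + 2)))))
  × (Even j → (φ^ (- (j + + 2)) ≺ d) × (d ≺ φ^ (- j)))

ColumnBounds-map : ∀ {_≺_ _≺′_ : ℤφ → ℤφ → Set} → (∀ {x y} → x ≺ y → x ≺′ y) →
                   ∀ j d → ColumnBounds _≺_ j d → ColumnBounds _≺′_ j d
ColumnBounds-map f _ _ (odd-bounds , even-bounds) =
  (λ odd → Data.Product.map f f (odd-bounds odd)) , (λ even → Data.Product.map f f (even-bounds even))

ColumnBounds-zero : ∀ d → φ⁻² <ᶜ d <ᶜ 1φ → ColumnBounds _<ᶜ_ (+ 0) d
ColumnBounds-zero _ bounds = (λ odd → ⊥-elim (¬odd-0 odd)) , (λ _ → bounds)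

ColumnBounds-pred : ∀ j d → ColumnBounds _<ᶜ_ j d → ColumnBounds _<ᶜ_ (j - + 1) (−φ* d)
ColumnBounds-pred j d (odd-bounds , even-bounds) =
    (λ odd → from-even (even-bounds (odd-pred⇒even odd)))
  , (λ even → from-odd (odd-bounds (even-pred⇒odd even)))
  where
  index-eq₁ : ∀ j → - j + + 1 ≡ - (j - + 1)
  index-eq₁ = solve-∀
  index-eq₂ : ∀ j → - (j + + 2) + + 1 ≡ - (j - + 1 + + 2)
  index-eq₂ = solve-∀
  −φ*-φ^′ : ∀ i {i′} → i + + 1 ≡ i′ → −φ* (φ^ i) ≡ neg (φ^ i′)
  −φ*-φ^′ i refl = −φ*-φ^ i
  −φ*-neg-φ^′ : ∀ i {i′} → i + + 1 ≡ i′ → −φ* (neg (φ^ i)) ≡ φ^ i′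
  −φ*-neg-φ^′ i refl = −φ*-neg-φ^ i
  from-even : φ^ (- (j + + 2)) <ᶜ d <ᶜ φ^ (- j) →
              neg (φ^ (- (j - + 1))) <ᶜ −φ* d <ᶜ neg (φ^ (- (j - + 1 + + 2)))
  from-even (lo , hi) = subst (_<ᶜ −φ* d) (−φ*-φ^′ (- j) (index-eq₁ j)) (−φ*-antitone hi)
                      , subst (−φ* d <ᶜ_) (−φ*-φ^′ (- (j + + 2)) (index-eq₂ j)) (−φ*-antitone lo)
  from-odd : neg (φ^ (- j)) <ᶜ d <ᶜ neg (φ^ (- (j + + 2))) →
             φ^ (- (j - + 1 + + 2)) <ᶜ −φ* d <ᶜ φ^ (- (j - + 1))
  from-odd (lo , hi) = subst (_<ᶜ −φ* d) (−φ*-neg-φ^′ (- (j + + 2)) (index-eq₂ j)) (−φ*-antitone hi)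
                     , subst (−φ* d <ᶜ_) (−φ*-neg-φ^′ (- j) (index-eq₁ j)) (−φ*-antitone lo)

column-bounds : ∀ x → IsRow x → ∀ n → ColumnBounds _<ᶜ_ (- + n) (colδ x (- + n))
column-bounds x row zero = ColumnBounds-zero (colδ x (+ 0)) (colδ-zero-bound x row)
column-bounds x row (suc n) =
  subst (λ j → ColumnBounds _<ᶜ_ j (colδ x j)) (pred-neg (+ n))
        (subst (ColumnBounds _<ᶜ_ (- + n - + 1)) (sym (colδ-pred x (row-recurrence x row) (- + n)))
               (ColumnBounds-pred (- + n) (colδ x (- + n)) (column-bounds x row n)))
  where
  pred-neg : ∀ i → - i - + 1 ≡ - (+ 1 + i)
  pred-neg = solve-∀

≤0⇒≡-n : ∀ {j} → j ≤ + 0 → ∃[ n ] j ≡ - + n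
≤0⇒≡-n {+ zero} _ = zero , refl
≤0⇒≡-n { -[1+ n ]} _ = suc n , refl
≤0⇒≡-n {+[1+ n ]} (+≤+ ())

lemma10 : (u v j : ℤ) → AndersonPairInColumn u v j → j ≤ + 0 →
            (Odd j → (neg (φ^ (- j)) <φ δ u v) × (δ u v <φ neg (φ^ (- (j + + 2)))))
            × (Even j → (φ^ (- (j + + 2)) <φ δ u v) × (δ u v <φ φ^ (- j)))
lemma10 _ _ j (x , row , refl , refl) j≤0 with ≤0⇒≡-n j≤0
... | n , refl = ColumnBounds-map {_<ᶜ_} {_<φ_} <ᶜ⇒<φ (- + n) (colδ x (- + n)) (column-bounds x row n)
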